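{- Let $\mathcal F\subseteq 2^{[n]}$ be induced $2C_2$-saturating. Then $\mathcal F$ contains a maximal chain of $2^{[n]}$, i.e., sets $\emptyset=A_0\subsetneq A_1\subsetneq\dots\subsetneq A_n=[n]$ with $|A_j|=j$. In particular, $\mathrm{sat}^*(n,2C_2)\ge n+2$ for every $n\ge 2$.
   Context: $2C_2$ is the poset on four elements $a<b$, $c<d$ with no other relations. A subfamily $\mathcal G\subseteq\mathcal F\subseteq 2^{[n]}$ is an induced copy of a poset $P$ if there is a bijection $i:P\to\mathcal G$ with $p\le_P q$ iff $i(p)\subseteq i(q)$; $\mathcal F$ is induced $P$-saturating if it has no induced copy of $P$ and adding any $G\in2^{[n]}\setminus\mathcal F$ creates one. $\mathrm{sat}^*(n,P)$ is the minimum size of an induced $P$-saturating family in $2^{[n]}$. -}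

module Defs where

open import Data.Nat using (ℕ; zero; suc)
open import Data.Fin using (Fin; zero; suc; toℕ; fromℕ) renaming (_≤_ to _≤ᶠ_)
open import Data.Fin.Subset using (Subset; _⊆_; ∣_∣; ⊥; ⊤)
open import Data.List using (List; _∷_)
open import Data.List.Membership.Propositional using (_∈_)
open import Data.List.Relation.Unary.Unique.Propositional using (Unique)
open import Data.Product using (Σ; _×_; ∃)
open import Function.Bundles using (_⇔_)
open import Function.Definitions using (Injective)
open import Relation.Binary.PropositionalEquality using (_≡_)
open import Relation.Nullary using (¬_)
open import Data.Empty using () renaming (⊥ to Empty)
open import Data.Unit using () renaming (⊤ to Unit)

-- A family 𝓕 ⊆ 2^[n] is represented as a duplicate-free list of subsets of Fin n.
-- Its size is the length of the list.

_≤2C2_ : Fin 4 → Fin 4 → Set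
zero ≤2C2 zero = Unit
zero ≤2C2 suc zero = Unit
suc zero ≤2C2 suc zero = Unit
suc (suc zero) ≤2C2 suc (suc zero) = Unit
suc (suc zero) ≤2C2 suc (suc (suc zero)) = Unit
suc (suc (suc zero)) ≤2C2 suc (suc (suc zero)) = Unit
_ ≤2C2 _ = Empty

InducedCopy2C2 : {n : ℕ} → List (Subset n) → Set
InducedCopy2C2 {n} 𝓕 =
  Σ (Fin 4 → Subset n) λ i →
    (∀ p → i p ∈ 𝓕) ×
    Injective _≡_ _≡_ i ×
    (∀ p q → (p ≤2C2 q) ⇔ (i p ⊆ i q))

InducedSaturating2C2 : {n : ℕ} → List (Subset n) → Set
InducedSaturating2C2 {n} 𝓕 =
  Unique 𝓕 ×
  ¬ InducedCopy2C2 𝓕 ×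
  (∀ (G : Subset n) → ¬ (G ∈ 𝓕) → InducedCopy2C2 (G ∷ 𝓕))

ContainsMaximalChain : {n : ℕ} → List (Subset n) → Set
ContainsMaximalChain {n} 𝓕 =
  Σ (Fin (suc n) → Subset n) λ A →
    (∀ j → A j ∈ 𝓕) ×
    (∀ j → ∣ A j ∣ ≡ toℕ j) ×
    (∀ i j → i ≤ᶠ j → A i ⊆ A j) ×
    (A zero ≡ ⊥) ×
    (A (fromℕ n) ≡ ⊤)

module Submission where

-- Call S compatible with 𝓕 when 𝓕 has no pair C ⊊ D with both C and D incomparable to S.
-- If 𝓕 is saturating, a compatible S lies in 𝓕: otherwise adding S creates an induced 2C₂,
-- and the chain of that copy not containing S is such a pair.  ∅ is compatible, and every
-- compatible A ≠ [n] grows by one element to a compatible set.  Otherwise each x ∉ A yields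
-- C ⊊ D in 𝓕 with x ∉ D ⊇ A and some y ∈ C ∖ A; since 𝓕 has no induced 2C₂, chasing y to
-- its own such pair, and so on, strictly shrinks the intersection of the D's met so far.
-- Growing ∅ one element at a time gives the maximal chain.  For n ≥ 2 some singleton G is off
-- the chain; if every member of 𝓕 were on it, G ∉ 𝓕 and the 2C₂ created by adding G would have
-- two incomparable members in 𝓕, both on the chain.  So 𝓕 has an (n + 2)-nd member.

open import Defs
open import Data.Nat using (ℕ; zero; suc; _+_; _≤_; _<_; _≤′_; ≤′-refl; ≤′-step; s≤s)
import Data.Nat.Properties as ℕ
open import Data.Nat.Induction using (<-wellFounded)
open import Induction.WellFounded using (Acc; acc)
import Data.Bool as Bool
open import Data.Fin using (Fin; zero; suc; toℕ; fromℕ)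
import Data.Fin.Properties as Fin
open import Data.Fin.Subset
  using (Subset; inside; outside; _⊆_; _⊈_; ∣_∣; ⊥; ⊤; _∩_; _∪_; ⁅_⁆; ⋂)
  renaming (_∈_ to _∈ₛ_; _∉_ to _∉ₛ_)
open import Data.Fin.Subset.Properties
  using (_⊆?_; ⊆-refl; ⊆-reflexive; ⊆-trans; ⊆-antisym; ⊆-min; ⊆⊤; ∈⊤; ∣⊥∣≡0; ∣⊤∣≡n; ∣p∣≡n⇒p≡⊤;
         p⊂q⇒∣p∣<∣q∣; p∩q⊆q; x∈p∩q⁺; x∈p∩q⁻; p⊆p∪q; x∈p∪q⁻; ∪-identityʳ; x∈⁅x⁆; x∈⁅y⁆⇒x≡y;
         ∣⁅x⁆∣≡1)
  renaming (_∈?_ to _∈ₛ?_)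
open import Data.Vec.Base using (_∷_; here; there)
open import Data.Vec.Properties using (≡-dec)
open import Data.List using (List; []; _∷_; length; lookup)
open import Data.List.Relation.Unary.All as All using (All; []; _∷_)
open import Data.List.Relation.Unary.Any as Any using (any?; index)
open import Data.List.Relation.Unary.Any.Properties using (lookup-index)
open import Data.List.Membership.Propositional using (_∈_; _∉_; find; lose)
open import Data.Product using (∃; ∃₂; _×_; _,_; proj₁; proj₂)
open import Data.Sum using (inj₁; inj₂)
open import Data.Unit using (tt)
open import Data.Empty using (⊥-elim) renaming (⊥ to Empty)
open import Function using (_∘_; id)
open import Function.Bundles using (_⇔_; Equivalence; mk⇔)
open import Function.Definitions using (Injective)
open import Relation.Binary.Definitions using (DecidableEquality)
open import Relation.Binary.PropositionalEquality
  using (_≡_; _≢_; refl; sym; trans; cong; subst; module ≡-Reasoning)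
open import Relation.Nullary using (¬_; Dec; yes; no; ¬?)
open import Relation.Nullary.Decidable using (_×-dec_; decidable-stable)

Incomparable : {A : Set} → (A → A → Set) → A → A → Set
Incomparable _≼_ x y = ¬ x ≼ y × ¬ y ≼ x

pattern a = zero
pattern b = suc zero
pattern c = suc (suc zero)
pattern d = suc (suc (suc zero))

≤2C2-refl : ∀ p → p ≤2C2 p
≤2C2-refl a = tt
≤2C2-refl b = tt
≤2C2-refl c = tt
≤2C2-refl d = tt

≤2C2-antisym : ∀ {p q} → p ≤2C2 q → q ≤2C2 p → p ≡ q
≤2C2-antisym {a} {a} _ _ = refl
≤2C2-antisym {b} {b} _ _ = refl
≤2C2-antisym {c} {c} _ _ = refl
≤2C2-antisym {d} {d} _ _ = refl
≤2C2-antisym {a} {b} _ ()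
≤2C2-antisym {a} {suc (suc _)} ()
≤2C2-antisym {b} {a} ()
≤2C2-antisym {b} {suc (suc _)} ()
≤2C2-antisym {c} {a} ()
≤2C2-antisym {c} {b} ()
≤2C2-antisym {c} {d} _ ()
≤2C2-antisym {d} {a} ()
≤2C2-antisym {d} {b} ()
≤2C2-antisym {d} {c} ()

incomparable⇒≢ : ∀ {p q} → Incomparable _≤2C2_ p q → q ≢ p
incomparable⇒≢ {p} (p≰q , _) refl = p≰q (≤2C2-refl p)

opposite-chain : ∀ p → ∃₂ λ q r → q ≤2C2 r × ¬ r ≤2C2 q ×
  Incomparable _≤2C2_ p q × Incomparable _≤2C2_ p r
opposite-chain a = c , d , tt , (λ ()) , ((λ ()) , (λ ())) , ((λ ()) , (λ ()))
opposite-chain b = c , d , tt , (λ ()) , ((λ ()) , (λ ())) , ((λ ()) , (λ ()))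
opposite-chain c = a , b , tt , (λ ()) , ((λ ()) , (λ ())) , ((λ ()) , (λ ()))
opposite-chain d = a , b , tt , (λ ()) , ((λ ()) , (λ ())) , ((λ ()) , (λ ()))

incomparable-pair-avoiding : ∀ p → ∃₂ λ q r → q ≢ p × r ≢ p × Incomparable _≤2C2_ q r
incomparable-pair-avoiding a = b , c , (λ ()) , (λ ()) , (λ ()) , (λ ())
incomparable-pair-avoiding b = a , c , (λ ()) , (λ ()) , (λ ()) , (λ ())
incomparable-pair-avoiding c = a , d , (λ ()) , (λ ()) , (λ ()) , (λ ())
incomparable-pair-avoiding d = a , c , (λ ()) , (λ ()) , (λ ()) , (λ ())

any-pair? : {A : Set} {R : A → A → Set} → (∀ x y → Dec (R x y)) →
  (xs : List A) → Dec (∃₂ λ x y → x ∈ xs × y ∈ xs × R x y)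
any-pair? R? xs with any? (λ x → any? (R? x) xs) xs
... | yes found =
  let x , x∈xs , found-y = find found
      y , y∈xs , Rxy = find found-y
  in yes (x , y , x∈xs , y∈xs , Rxy)
... | no none = no λ (x , y , x∈xs , y∈xs , Rxy) → none (lose x∈xs (lose y∈xs Rxy))

injective⇒≤length : {A : Set} {m : ℕ} {xs : List A} (f : Fin m → A) →
  Injective _≡_ _≡_ f → (∀ j → f j ∈ xs) → m ≤ length xs
injective⇒≤length {xs = xs} f f-injective f∈xs = Fin.injective⇒≤ position-injective
  where
  open ≡-Reasoning
  position-injective : Injective _≡_ _≡_ (index ∘ f∈xs)
  position-injective {j} {k} same-position = f-injective (begin
    f j                          ≡⟨ lookup-index (f∈xs j) ⟩
    lookup xs (index (f∈xs j))   ≡⟨ cong (lookup xs) same-position ⟩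
    lookup xs (index (f∈xs k))   ≡⟨ lookup-index (f∈xs k) ⟨
    f k                          ∎)

∣p∪⁅x⁆∣≡1+∣p∣ : ∀ {n} (p : Subset n) (x : Fin n) → x ∉ₛ p → ∣ p ∪ ⁅ x ⁆ ∣ ≡ suc ∣ p ∣
∣p∪⁅x⁆∣≡1+∣p∣ (inside ∷ p) zero x∉p = ⊥-elim (x∉p here)
∣p∪⁅x⁆∣≡1+∣p∣ (outside ∷ p) zero _ = cong (suc ∘ ∣_∣) (∪-identityʳ p)
∣p∪⁅x⁆∣≡1+∣p∣ (inside ∷ p) (suc x) x∉p = cong suc (∣p∪⁅x⁆∣≡1+∣p∣ p x (x∉p ∘ there))
∣p∪⁅x⁆∣≡1+∣p∣ (outside ∷ p) (suc x) x∉p = ∣p∪⁅x⁆∣≡1+∣p∣ p x (x∉p ∘ there)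

module _ {n : ℕ} where

  _≟ₛ_ : DecidableEquality (Subset n)
  _≟ₛ_ = ≡-dec Bool._≟_

  _⊊_ : Subset n → Subset n → Set
  X ⊊ Y = X ⊆ Y × Y ⊈ X

  ⊈⇒∃∉ : {X Y : Subset n} → X ⊈ Y → ∃ λ y → y ∈ₛ X × y ∉ₛ Y
  ⊈⇒∃∉ {X} {Y} X⊈Y with Fin.any? (λ y → (y ∈ₛ? X) ×-dec ¬? (y ∈ₛ? Y))
  ... | yes found = found
  ... | no none = ⊥-elim (X⊈Y λ {y} y∈X →
    decidable-stable (y ∈ₛ? Y) λ y∉Y → none (y , y∈X , y∉Y))

  ≢⊤⇒∃∉ : {X : Subset n} → X ≢ ⊤ → ∃ λ x → x ∉ₛ X
  ≢⊤⇒∃∉ X≢⊤ =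
    let x , _ , x∉X = ⊈⇒∃∉ (λ ⊤⊆X → X≢⊤ (⊆-antisym ⊆⊤ ⊤⊆X)) in x , x∉X

  p∪⁅x⁆⊆q : {p q : Subset n} {x : Fin n} → p ⊆ q → x ∈ₛ q → p ∪ ⁅ x ⁆ ⊆ q
  p∪⁅x⁆⊆q {p} {x = x} p⊆q x∈q y∈p∪⁅x⁆ with x∈p∪q⁻ p ⁅ x ⁆ y∈p∪⁅x⁆
  ... | inj₁ y∈p = p⊆q y∈p
  ... | inj₂ y∈⁅x⁆ = subst (_∈ₛ _) (sym (x∈⁅y⁆⇒x≡y x y∈⁅x⁆)) x∈q

  x∈⋂⁺ : {x : Fin n} {T : List (Subset n)} → All (x ∈ₛ_) T → x ∈ₛ ⋂ T
  x∈⋂⁺ [] = ∈⊤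
  x∈⋂⁺ (x∈D ∷ x∈T) = x∈p∩q⁺ (x∈D , x∈⋂⁺ x∈T)

  IncomparableChain : List (Subset n) → Subset n → Set
  IncomparableChain F S = ∃₂ λ C D → C ∈ F × D ∈ F × C ⊊ D ×
    Incomparable _⊆_ S C × Incomparable _⊆_ S D

  incomparableChain? : ∀ F S → Dec (IncomparableChain F S)
  incomparableChain? F S = any-pair? (λ C D →
    ((C ⊆? D) ×-dec ¬? (D ⊆? C)) ×-dec incomparable? C ×-dec incomparable? D) F
    where
    incomparable? : ∀ X → Dec (Incomparable _⊆_ S X)
    incomparable? X = ¬? (S ⊆? X) ×-dec ¬? (X ⊆? S)

module _ {n : ℕ} {F : List (Subset n)} where

  induced-copy : {C D C′ D′ : Subset n} → C ∈ F → D ∈ F → C′ ∈ F → D′ ∈ F →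
    C ⊊ D → C′ ⊊ D′ → C ⊈ D′ → C′ ⊈ D → InducedCopy2C2 F
  induced-copy {C} {D} {C′} {D′} C∈F D∈F C′∈F D′∈F (C⊆D , D⊈C) (C′⊆D′ , D′⊈C′) C⊈D′ C′⊈D =
    i , i∈F , injective , λ p q → mk⇔ (monotone p q) (reflects p q)
    where
    i : Fin 4 → Subset n
    i a = C
    i b = D
    i c = C′
    i d = D′

    i∈F : ∀ p → i p ∈ F
    i∈F a = C∈F
    i∈F b = D∈F
    i∈F c = C′∈F
    i∈F d = D′∈F

    monotone : ∀ p q → p ≤2C2 q → i p ⊆ i q
    monotone a a _ = ⊆-refl
    monotone a b _ = C⊆D
    monotone b b _ = ⊆-refl
    monotone c c _ = ⊆-refl
    monotone c d _ = C′⊆D′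
    monotone d d _ = ⊆-refl
    monotone a (suc (suc _)) ()
    monotone b a ()
    monotone b (suc (suc _)) ()
    monotone c a ()
    monotone c b ()
    monotone d a ()
    monotone d b ()
    monotone d c ()

    reflects : ∀ p q → i p ⊆ i q → p ≤2C2 q
    reflects a a _ = tt
    reflects a b _ = tt
    reflects b b _ = tt
    reflects c c _ = tt
    reflects c d _ = tt
    reflects d d _ = tt
    reflects a c C⊆C′ = ⊥-elim (C⊈D′ (⊆-trans C⊆C′ C′⊆D′))
    reflects a d C⊆D′ = ⊥-elim (C⊈D′ C⊆D′)
    reflects b a D⊆C = ⊥-elim (D⊈C D⊆C)
    reflects b c D⊆C′ = ⊥-elim (C⊈D′ (⊆-trans C⊆D (⊆-trans D⊆C′ C′⊆D′)))
    reflects b d D⊆D′ = ⊥-elim (C⊈D′ (⊆-trans C⊆D D⊆D′))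
    reflects c a C′⊆C = ⊥-elim (C′⊈D (⊆-trans C′⊆C C⊆D))
    reflects c b C′⊆D = ⊥-elim (C′⊈D C′⊆D)
    reflects d a D′⊆C = ⊥-elim (C′⊈D (⊆-trans C′⊆D′ (⊆-trans D′⊆C C⊆D)))
    reflects d b D′⊆D = ⊥-elim (C′⊈D (⊆-trans C′⊆D′ D′⊆D))
    reflects d c D′⊆C′ = ⊥-elim (D′⊈C′ D′⊆C′)

    injective : Injective _≡_ _≡_ i
    injective {p} {q} ip≡iq =
      ≤2C2-antisym (reflects p q (⊆-reflexive ip≡iq)) (reflects q p (⊆-reflexive (sym ip≡iq)))

module _ {n : ℕ} {F : List (Subset n)} {S : Subset n} (S∉F : S ∉ F)
         (no-copy : ¬ InducedCopy2C2 F) where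

  copy-meets-new : (copy : InducedCopy2C2 (S ∷ F)) →
    ∃ λ p → proj₁ copy p ≡ S × (∀ q → q ≢ p → proj₁ copy q ∈ F)
  copy-meets-new (i , i∈S∷F , i-injective , i-iff) with Fin.any? (λ p → i p ≟ₛ S)
  ... | yes (p , ip≡S) =
    p , ip≡S , λ q q≢p → Any.tail (λ iq≡S → q≢p (i-injective (trans iq≡S (sym ip≡S)))) (i∈S∷F q)
  ... | no S∉image =
    ⊥-elim (no-copy (i , (λ p → Any.tail (λ ip≡S → S∉image (p , ip≡S)) (i∈S∷F p)) , i-injective , i-iff))

  module _ (copy : InducedCopy2C2 (S ∷ F)) where

    private
      i : Fin 4 → Subset n
      i = proj₁ copy

      iff : ∀ p q → p ≤2C2 q ⇔ i p ⊆ i q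
      iff = proj₂ (proj₂ (proj₂ copy))

      reflects-≰ : ∀ {p q} → ¬ p ≤2C2 q → i p ⊈ i q
      reflects-≰ {p} {q} p≰q = p≰q ∘ Equivalence.from (iff p q)

      reflects-incomparable : ∀ {p q} → Incomparable _≤2C2_ p q → Incomparable _⊆_ (i p) (i q)
      reflects-incomparable (p≰q , q≰p) = reflects-≰ p≰q , reflects-≰ q≰p

    new-set-incomparableChain : IncomparableChain F S
    new-set-incomparableChain =
      let p , ip≡S , i∈F = copy-meets-new copy
          q , r , q≤r , r≰q , p∥q , p∥r = opposite-chain p
      in subst (IncomparableChain F) ip≡S
        ( i q , i r , i∈F q (incomparable⇒≢ p∥q) , i∈F r (incomparable⇒≢ p∥r)
        , (Equivalence.to (iff q r) q≤r , reflects-≰ r≰q)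
        , reflects-incomparable p∥q , reflects-incomparable p∥r )

    new-set-incomparable-pair : ∃₂ λ X Y → X ∈ F × Y ∈ F × Incomparable _⊆_ X Y
    new-set-incomparable-pair =
      let p , _ , i∈F = copy-meets-new copy
          q , r , q≢p , r≢p , q∥r = incomparable-pair-avoiding p
      in i q , i r , i∈F q q≢p , i∈F r r≢p , reflects-incomparable q∥r

module NoInducedCopy {n : ℕ} (F : List (Subset n)) (no-copy : ¬ InducedCopy2C2 F) where

  Compatible : Subset n → Set
  Compatible S = ¬ IncomparableChain F S

  compatible-⊥ : Compatible ⊥
  compatible-⊥ (C , _ , _ , _ , _ , (⊥⊈C , _) , _) = ⊥⊈C (⊆-min C)

  crossing-⊆ : {C D C′ D′ : Subset n} {y : Fin n} → C ∈ F → D ∈ F → C′ ∈ F → D′ ∈ F →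
    C ⊊ D → C′ ⊊ D′ → y ∈ₛ C → y ∉ₛ D′ → C′ ⊆ D
  crossing-⊆ {D = D} {C′} C∈F D∈F C′∈F D′∈F C⊊D C′⊊D′ y∈C y∉D′ =
    decidable-stable (C′ ⊆? D) λ C′⊈D →
      no-copy (induced-copy C∈F D∈F C′∈F D′∈F C⊊D C′⊊D′ (λ C⊆D′ → y∉D′ (C⊆D′ y∈C)) C′⊈D)

  record Obstruction (A : Subset n) (x : Fin n) : Set where
    field
      {C D} : Subset n
      C∈F : C ∈ F
      D∈F : D ∈ F
      C⊊D : C ⊊ D
      x∉D : x ∉ₛ D
      y : Fin n
      y∈C : y ∈ₛ C
      y∉A : y ∉ₛ A

  obstruction : {A : Subset n} {x : Fin n} →
    Compatible A → IncomparableChain F (A ∪ ⁅ x ⁆) → Obstruction A x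
  obstruction {A} {x} A-compatible
    (C , D , C∈F , D∈F , C⊊D@(C⊆D , _) , (_ , C⊈A∪⁅x⁆) , (A∪⁅x⁆⊈D , _))
    with ⊈⇒∃∉ C⊈A∪⁅x⁆
  ... | y , y∈C , y∉A∪⁅x⁆ =
    record { C∈F = C∈F ; D∈F = D∈F ; C⊊D = C⊊D ; x∉D = A∪⁅x⁆⊈D ∘ p∪⁅x⁆⊆q A⊆D
           ; y = y ; y∈C = y∈C ; y∉A = y∉A }
    where
    y∉A : y ∉ₛ A
    y∉A = y∉A∪⁅x⁆ ∘ p⊆p∪q ⁅ x ⁆
    A⊆D : A ⊆ D
    A⊆D = decidable-stable (A ⊆? D) λ A⊈D → A-compatible
      ( C , D , C∈F , D∈F , C⊊D
      , ((λ A⊆C → A⊈D (⊆-trans A⊆C C⊆D)) , λ C⊆A → y∉A (C⊆A y∈C))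
      , (A⊈D , λ D⊆A → y∉A (D⊆A (C⊆D y∈C))) )

  -- The obstruction at y gives C′ ⊊ D′ with y ∉ D′, and crossing-⊆ puts C′ below every D
  -- collected so far; so D′ can join T, and ⋂ T loses y.
  descent : {A C : Subset n} {y : Fin n} (T : List (Subset n)) → Acc _<_ ∣ ⋂ T ∣ →
    (∀ x → x ∉ₛ A → Obstruction A x) →
    C ∈ F → y ∈ₛ C → y ∉ₛ A → All (λ D → D ∈ F × C ⊊ D) T → Empty
  descent {A} {C} {y} T (acc smaller) obstruct C∈F y∈C y∉A T-above =
    descent (D′ ∷ T) (smaller shrinks) obstruct C′∈F y′∈C′ y′∉A
      ((D′∈F , C′⊊D′) ∷ All.map above T-above)
    where
    open Obstruction (obstruct y y∉A) renaming
      (C to C′; D to D′; C∈F to C′∈F; D∈F to D′∈F; C⊊D to C′⊊D′; x∉D to y∉D′;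
       y to y′; y∈C to y′∈C′; y∉A to y′∉A)
    above : {D : Subset n} → D ∈ F × C ⊊ D → D ∈ F × C′ ⊊ D
    above (D∈F , C⊊D) =
      D∈F , crossing-⊆ C∈F D∈F C′∈F D′∈F C⊊D C′⊊D′ y∈C y∉D′ ,
      λ D⊆C′ → y∉D′ (proj₁ C′⊊D′ (D⊆C′ (proj₁ C⊊D y∈C)))
    shrinks : ∣ D′ ∩ ⋂ T ∣ < ∣ ⋂ T ∣
    shrinks = p⊂q⇒∣p∣<∣q∣
      ( p∩q⊆q D′ (⋂ T)
      , y , x∈⋂⁺ (All.map (λ (_ , C⊆D , _) → C⊆D y∈C) T-above)
      , y∉D′ ∘ proj₁ ∘ x∈p∩q⁻ D′ (⋂ T) )

  extend : {A : Subset n} → Compatible A → A ≢ ⊤ → ∃ λ x → x ∉ₛ A × Compatible (A ∪ ⁅ x ⁆)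
  extend {A} A-compatible A≢⊤
    with Fin.any? (λ x → ¬? (x ∈ₛ? A) ×-dec ¬? (incomparableChain? F (A ∪ ⁅ x ⁆)))
  ... | yes found = found
  ... | no none = ⊥-elim (descent (D ∷ []) (<-wellFounded _) obstruct C∈F y∈C y∉A ((D∈F , C⊊D) ∷ []))
    where
    obstruct : ∀ x → x ∉ₛ A → Obstruction A x
    obstruct x x∉A = obstruction A-compatible
      (decidable-stable (incomparableChain? F (A ∪ ⁅ x ⁆)) λ compatible → none (x , x∉A , compatible))
    open Obstruction (obstruct _ (proj₂ (≢⊤⇒∃∉ A≢⊤)))

module Saturated {n : ℕ} (F : List (Subset n)) (saturated : InducedSaturating2C2 F) where

  no-copy : ¬ InducedCopy2C2 F
  no-copy = proj₁ (proj₂ saturated)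

  open NoInducedCopy F no-copy

  copy-with : {S : Subset n} → S ∉ F → InducedCopy2C2 (S ∷ F)
  copy-with = proj₂ (proj₂ saturated) _

  compatible⇒∈ : {S : Subset n} → Compatible S → S ∈ F
  compatible⇒∈ {S} S-compatible = decidable-stable (any? (S ≟ₛ_) F) λ S∉F →
    S-compatible (new-set-incomparableChain S∉F no-copy (copy-with S∉F))

  record Growth (A : Subset n) : Set where
    field
      next : Subset n
      next-compatible : Compatible next
      ⊆-next : A ⊆ next
      ∣next∣ : A ≢ ⊤ → ∣ next ∣ ≡ suc ∣ A ∣

  grow : {A : Subset n} → Compatible A → Growth A
  grow {A} A-compatible with A ≟ₛ ⊤
  ... | yes A≡⊤ = record
    { next = A ; next-compatible = A-compatible ; ⊆-next = id ; ∣next∣ = λ A≢⊤ → ⊥-elim (A≢⊤ A≡⊤) }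
  ... | no A≢⊤ =
    let x , x∉A , compatible = extend A-compatible A≢⊤
    in record { next = A ∪ ⁅ x ⁆ ; next-compatible = compatible ; ⊆-next = p⊆p∪q ⁅ x ⁆
              ; ∣next∣ = λ _ → ∣p∪⁅x⁆∣≡1+∣p∣ A x x∉A }

  level : ℕ → Subset n
  level-compatible : ∀ k → Compatible (level k)

  level zero = ⊥
  level (suc k) = Growth.next (grow (level-compatible k))

  level-compatible zero = compatible-⊥
  level-compatible (suc k) = Growth.next-compatible (grow (level-compatible k))

  level-mono : {j k : ℕ} → j ≤′ k → level j ⊆ level k
  level-mono ≤′-refl = ⊆-refl
  level-mono {k = suc k} (≤′-step j≤′k) =
    ⊆-trans (level-mono j≤′k) (Growth.⊆-next (grow (level-compatible k)))

  ∣level∣ : ∀ k → k ≤ n → ∣ level k ∣ ≡ k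
  ∣level∣ zero _ = ∣⊥∣≡0 n
  ∣level∣ (suc k) k<n = trans (Growth.∣next∣ (grow (level-compatible k)) level≢⊤) (cong suc IH)
    where
    IH : ∣ level k ∣ ≡ k
    IH = ∣level∣ k (ℕ.<⇒≤ k<n)
    level≢⊤ : level k ≢ ⊤
    level≢⊤ level≡⊤ = ℕ.<⇒≢ k<n (trans (sym IH) (trans (cong ∣_∣ level≡⊤) (∣⊤∣≡n n)))

  chain : Fin (suc n) → Subset n
  chain j = level (toℕ j)

  chain-∈ : ∀ j → chain j ∈ F
  chain-∈ j = compatible⇒∈ (level-compatible (toℕ j))

  ∣chain∣ : ∀ j → ∣ chain j ∣ ≡ toℕ j
  ∣chain∣ j = ∣level∣ (toℕ j) (ℕ.≤-pred (Fin.toℕ<n j))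

  ∣chain∣-injective : {j k : Fin (suc n)} → ∣ chain j ∣ ≡ ∣ chain k ∣ → j ≡ k
  ∣chain∣-injective {j} {k} ∣j∣≡∣k∣ =
    Fin.toℕ-injective (trans (sym (∣chain∣ j)) (trans ∣j∣≡∣k∣ (∣chain∣ k)))

  maximal-chain : ContainsMaximalChain F
  maximal-chain =
    chain , chain-∈ , ∣chain∣ , (λ _ _ i≤j → level-mono (ℕ.≤⇒≤′ i≤j)) , refl ,
    ∣p∣≡n⇒p≡⊤ (trans (∣chain∣ (fromℕ n)) (Fin.toℕ-fromℕ n))

  OnChain : Subset n → Set
  OnChain X = ∃ λ j → X ≡ chain j

  onChain? : ∀ X → Dec (OnChain X)
  onChain? X = Fin.any? (λ j → X ≟ₛ chain j)

  onChain-comparable : {X Y : Subset n} → OnChain X → OnChain Y → ¬ Incomparable _⊆_ X Y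
  onChain-comparable (j , refl) (k , refl) (j⊈k , k⊈j) with ℕ.≤-total (toℕ j) (toℕ k)
  ... | inj₁ j≤k = j⊈k (level-mono (ℕ.≤⇒≤′ j≤k))
  ... | inj₂ k≤j = k⊈j (level-mono (ℕ.≤⇒≤′ k≤j))

  onChain-∣∣-injective : {X Y : Subset n} → OnChain X → OnChain Y → ∣ X ∣ ≡ ∣ Y ∣ → X ≡ Y
  onChain-∣∣-injective (j , refl) (k , refl) ∣j∣≡∣k∣ = cong chain (∣chain∣-injective {j} {k} ∣j∣≡∣k∣)

  off-chain-singleton : {x y : Fin n} → x ≢ y → ∃ λ G → ¬ OnChain G
  off-chain-singleton {x} {y} x≢y with onChain? ⁅ x ⁆
  ... | no x-off = ⁅ x ⁆ , x-off
  ... | yes x-on = ⁅ y ⁆ , λ y-on →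
    let ⁅x⁆≡⁅y⁆ = onChain-∣∣-injective x-on y-on (trans (∣⁅x⁆∣≡1 x) (sym (∣⁅x⁆∣≡1 y)))
    in x≢y (x∈⁅y⁆⇒x≡y y (subst (x ∈ₛ_) ⁅x⁆≡⁅y⁆ (x∈⁅x⁆ x)))

  off-chain-member : {G : Subset n} → ¬ OnChain G → ∃ λ H → H ∈ F × ¬ OnChain H
  off-chain-member {G} G-off with any? (¬? ∘ onChain?) F
  ... | yes found = find found
  ... | no none =
    let X , Y , X∈F , Y∈F , X∥Y = new-set-incomparable-pair G∉F no-copy (copy-with G∉F)
    in ⊥-elim (onChain-comparable (on-chain X∈F) (on-chain Y∈F) X∥Y)
    where
    on-chain : {H : Subset n} → H ∈ F → OnChain H
    on-chain {H} H∈F = decidable-stable (onChain? H) λ H-off → none (lose H∈F H-off)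
    G∉F : G ∉ F
    G∉F = G-off ∘ on-chain

  chain⁺ : Subset n → Fin (suc (suc n)) → Subset n
  chain⁺ G zero = G
  chain⁺ G (suc j) = chain j

  chain⁺-injective : {G : Subset n} → ¬ OnChain G → Injective _≡_ _≡_ (chain⁺ G)
  chain⁺-injective G-off {zero} {zero} _ = refl
  chain⁺-injective G-off {zero} {suc k} G≡k = ⊥-elim (G-off (k , G≡k))
  chain⁺-injective G-off {suc j} {zero} j≡G = ⊥-elim (G-off (j , sym j≡G))
  chain⁺-injective G-off {suc j} {suc k} j≡k =
    cong suc (∣chain∣-injective (cong ∣_∣ j≡k))

  size-bound : {x y : Fin n} → x ≢ y → suc (suc n) ≤ length F
  size-bound x≢y =
    let G , G∈F , G-off = off-chain-member (proj₂ (off-chain-singleton x≢y))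
    in injective⇒≤length (chain⁺ G) (chain⁺-injective G-off) λ where
         zero → G∈F
         (suc j) → chain-∈ j

theorem21 : (∀ (n : ℕ) (𝓕 : List (Subset n)) → InducedSaturating2C2 𝓕 → ContainsMaximalChain 𝓕)
    × (∀ (n : ℕ) → 2 ≤ n → ∀ (𝓕 : List (Subset n)) → InducedSaturating2C2 𝓕 → n + 2 ≤ length 𝓕)
theorem21 = (λ _ 𝓕 saturated → Saturated.maximal-chain 𝓕 saturated) , size-bound
  where
  size-bound : ∀ (n : ℕ) → 2 ≤ n → ∀ (𝓕 : List (Subset n)) → InducedSaturating2C2 𝓕 → n + 2 ≤ length 𝓕
  size-bound 1 (s≤s ())
  size-bound (suc (suc m)) _ 𝓕 saturated =
    subst (_≤ length 𝓕) (ℕ.+-comm 2 (suc (suc m)))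
      (Saturated.size-bound 𝓕 saturated {zero} {suc zero} λ ())
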